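{- For distinct patterns $\pi_1,\pi_2\in\mathfrak{S}_3$, the equality $\sum_{\iota\in\mathcal{I}_n(\pi_1)}q^{\mathrm{inv}(\iota)}=\sum_{\iota\in\mathcal{I}_n(\pi_2)}q^{\mathrm{inv}(\iota)}$ holds for all $n\geq 0$ if and only if $\{\pi_1,\pi_2\}=\{132,213\}$ or $\{\pi_1,\pi_2\}=\{231,312\}$.
   Context: A permutation $\sigma$ of $[n]$ (one-line notation) contains a pattern $\pi\in\mathfrak{S}_k$ if some subsequence $\sigma(m_1)\cdots\sigma(m_k)$ with $m_1<\dots<m_k$ is in the same relative order as $\pi$; otherwise it avoids $\pi$. $\mathcal{I}_n(\pi)$ is the set of involutions ($\iota^2=\mathrm{id}$) of $[n]$ avoiding $\pi$. $\mathrm{inv}(\sigma)$ is the number of pairs $i<j$ with $\sigma(i)>\sigma(j)$. -}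

module Defs where

open import Data.Nat using (ℕ; zero; suc)
open import Data.Nat.Properties using () renaming (_≟_ to _≟ℕ_)
open import Data.Fin using (Fin; _<_; _<?_)
open import Data.Fin.Properties using (any?; all?; _≟_)
open import Data.Vec using (Vec; []; _∷_; lookup)
open import Data.List using (List; [_]; map; concatMap; filter; length; allFin; cartesianProduct)
open import Data.Product using (Σ; ∃; _×_; _,_)
open import Relation.Binary.PropositionalEquality using (_≡_)
open import Relation.Nullary using (Dec; ¬_; ¬?)
open import Relation.Nullary.Decidable using (_×-dec_; _→-dec_)

-- A word of length n over [n] (0-indexed values), i.e. a map [n] → [n] in one-line notation.
Word : ℕ → Set
Word n = Vec (Fin n) n

allVecs : {A : Set} → List A → (m : ℕ) → List (Vec A m)
allVecs xs zero    = [ [] ]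
allVecs xs (suc m) = concatMap (λ x → map (x ∷_) (allVecs xs m)) xs

allWords : (n : ℕ) → List (Word n)
allWords n = allVecs (allFin n) n

-- ι is an involution: ι(ι(i)) = i for all i  (this forces ι to be a permutation)
IsInvolution : {n : ℕ} → Word n → Set
IsInvolution {n} ι = ∀ (i : Fin n) → lookup ι (lookup ι i) ≡ i

isInvolution? : {n : ℕ} → (ι : Word n) → Dec (IsInvolution ι)
isInvolution? ι = all? (λ i → lookup ι (lookup ι i) ≟ i)

-- Patterns of length 3: one-line words over {0,1,2} (digit d of the paper is d-1 here).
Pattern3 : Set
Pattern3 = Vec (Fin 3) 3

IsPerm3 : Pattern3 → Set
IsPerm3 π = ∀ (a b : Fin 3) → lookup π a ≡ lookup π b → a ≡ b

SameOrder : {n : ℕ} → Word n → Pattern3 → Fin n → Fin n → Fin n → Set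
SameOrder σ π i j l =
  ∀ (a b : Fin 3) →
    ((lookup σ (lookup m a) < lookup σ (lookup m b)) → (lookup π a < lookup π b)) ×
    ((lookup π a < lookup π b) → (lookup σ (lookup m a) < lookup σ (lookup m b)))
  where m = i ∷ j ∷ l ∷ []

Contains : {n : ℕ} → Word n → Pattern3 → Set
Contains {n} σ π = Σ (Fin n) λ i → Σ (Fin n) λ j → Σ (Fin n) λ l →
  (i < j) × (j < l) × SameOrder σ π i j l

contains? : {n : ℕ} → (σ : Word n) → (π : Pattern3) → Dec (Contains σ π)
contains? σ π = any? λ i → any? λ j → any? λ l →
  (i <? j) ×-dec ((j <? l) ×-dec
    all? (λ a → all? (λ b →
      ((lookup σ (lookup (i ∷ j ∷ l ∷ []) a) <? lookup σ (lookup (i ∷ j ∷ l ∷ []) b)) →-dec (lookup π a <? lookup π b))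
      ×-dec
      ((lookup π a <? lookup π b) →-dec (lookup σ (lookup (i ∷ j ∷ l ∷ []) a) <? lookup σ (lookup (i ∷ j ∷ l ∷ []) b))))))

invAvoiders : (π : Pattern3) (n : ℕ) → List (Word n)
invAvoiders π n = filter (λ ι → ¬? (contains? ι π)) (filter isInvolution? (allWords n))

inv : {n : ℕ} → Word n → ℕ
inv {n} σ = length (filter (λ { (i , j) → (i <? j) ×-dec (lookup σ j <? lookup σ i) })
                           (cartesianProduct (allFin n) (allFin n)))

-- The polynomial  Σ_{ι ∈ 𝓘ₙ(π)} q^{inv ι}, represented by its coefficient sequence:
-- invPoly π n k = coefficient of q^k.
invPoly : Pattern3 → ℕ → (ℕ → ℕ)
invPoly π n k = length (filter (λ ι → inv ι ≟ℕ k) (invAvoiders π n))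

SameInvPoly : Pattern3 → Pattern3 → ℕ → Set
SameInvPoly π₁ π₂ n = ∀ (k : ℕ) → invPoly π₁ n k ≡ invPoly π₂ n k

p132 p213 p231 p312 : Pattern3
p132 = Fin.zero ∷ Fin.suc (Fin.suc Fin.zero) ∷ Fin.suc Fin.zero ∷ []
  where import Data.Fin as Fin
p213 = Fin.suc Fin.zero ∷ Fin.zero ∷ Fin.suc (Fin.suc Fin.zero) ∷ []
  where import Data.Fin as Fin
p231 = Fin.suc Fin.zero ∷ Fin.suc (Fin.suc Fin.zero) ∷ Fin.zero ∷ []
  where import Data.Fin as Fin
p312 = Fin.suc (Fin.suc Fin.zero) ∷ Fin.zero ∷ Fin.suc Fin.zero ∷ []
  where import Data.Fin as Fin

SetEq2 : Pattern3 → Pattern3 → Pattern3 → Pattern3 → Set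
SetEq2 π₁ π₂ α β = ((π₁ ≡ α) × (π₂ ≡ β)) ⊎' ((π₁ ≡ β) × (π₂ ≡ α))
  where open import Data.Sum using () renaming (_⊎_ to _⊎'_)

module Submission where

-- "If": both equalities come from one double-counting principle (invPoly-symmetry):
-- an involutive symmetry of words which preserves involutions and inversion numbers
-- and exchanges containment of the two patterns identifies the counted sets.
--   * 132 and 213 are reverse-complements of each other, and reverse-complement
--     preserves involutions, inversions and pattern containment (invPoly-rc).
--   * 231 and 312 are inverse permutations, and an involution contains a pattern
--     iff it contains the inverse pattern, so the identity symmetry works
--     (invPoly-inverse); this uses the description of an occurrence of a permutation
--     pattern as an increasing chain of values (sameOrder⇔chain).
-- "Only if": every permutation of length 3 is one of six words, and already for n = 3
-- the coefficient lists of the six polynomials separate all other pairs; both facts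
-- are finite checks carried out by evaluating decision procedures.

open import Defs
open import Data.Nat using (ℕ; zero; suc; s≤s; z≤n)
open import Data.Nat.Properties using () renaming (_≟_ to _≟ℕ_; ∸-monoʳ-< to ∸-monoʳ-<ℕ)
open import Data.Fin using (Fin; zero; suc; _<_; opposite)
open import Data.Fin.Properties using (all?; _≟_; opposite-prop; opposite-involutive; toℕ<n; <-cmp; <-irrefl; <-asym; <-trans)
open import Data.Vec using (Vec; []; _∷_; lookup; tabulate)
open import Data.Vec.Properties using (lookup∘tabulate; tabulate-cong; tabulate∘lookup; ∷-injectiveˡ; ∷-injectiveʳ) renaming (≡-dec to ≡-decᵥ)
open import Data.List using (List; []; _∷_; map; filter; length; allFin; cartesianProduct)
open import Data.List.Properties using (map-cong; length-map; filter-≐) renaming (≡-dec to ≡-decₗ)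
open import Data.List.Membership.Propositional using (_∈_)
open import Data.List.Membership.Propositional.Properties using (∈-map⁺; ∈-map⁻; ∈-concat⁺′; ∈-cartesianProduct⁺; ∈-allFin)
open import Data.List.Membership.Propositional.Properties.WithK using (unique∧set⇒bag)
open import Data.List.Relation.Unary.All as All using (All)
open import Data.List.Relation.Unary.Any using (here)
import Data.List.Relation.Unary.All.Properties as AllProperties
import Data.List.Relation.Unary.AllPairs as AllPairs
import Data.List.Relation.Unary.AllPairs.Properties as AllPairsProperties
open import Data.List.Relation.Unary.Unique.Propositional using (Unique)
import Data.List.Relation.Unary.Unique.Propositional.Properties as Unique
open import Data.List.Relation.Binary.BagAndSetEquality using (∼bag⇒↭)
open import Data.List.Relation.Binary.Permutation.Propositional using (_↭_)
open import Data.List.Relation.Binary.Permutation.Propositional.Properties using (↭-length; filter-↭)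
open import Data.Product using (_×_; _,_; proj₁; proj₂; swap)
open import Data.Sum using (_⊎_; inj₁; inj₂)
open import Data.Empty using (⊥-elim)
open import Function using (_∘_; id)
open import Function.Bundles using (_⇔_; mk⇔; Equivalence)
open import Level using (0ℓ)
open import Relation.Binary using (tri<; tri≈; tri>)
open import Relation.Binary.PropositionalEquality
open import Relation.Nullary using (Dec; yes; no; ¬_; ¬?; contradiction)
open import Relation.Nullary.Decidable using (_×-dec_; _⊎-dec_; _→-dec_; from-yes)
open import Relation.Unary using (Pred; Decidable)

open Equivalence using (to; from)

module _ {A : Set} where

  filter-filter : ∀ {P Q : Pred A 0ℓ} (P? : Decidable P) (Q? : Decidable Q) xs →
    filter Q? (filter P? xs) ≡ filter (λ x → P? x ×-dec Q? x) xs
  filter-filter P? Q? [] = refl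
  filter-filter P? Q? (x ∷ xs) with P? x
  ... | no _ = filter-filter P? Q? xs
  ... | yes _ with Q? x
  ...   | yes _ = cong (x ∷_) (filter-filter P? Q? xs)
  ...   | no _ = filter-filter P? Q? xs

  filter-map : ∀ {P : Pred A 0ℓ} (P? : Decidable P) (f : A → A) xs →
    filter P? (map f xs) ≡ map f (filter (P? ∘ f) xs)
  filter-map P? f [] = refl
  filter-map P? f (x ∷ xs) with P? (f x)
  ... | yes _ = cong (f x ∷_) (filter-map P? f xs)
  ... | no _ = filter-map P? f xs

  map-involution-↭ : (f : A → A) → (∀ x → f (f x) ≡ x) →
    ∀ xs → Unique xs → (∀ x → x ∈ xs) → map f xs ↭ xs
  map-involution-↭ f f-invol xs unique complete =
    ∼bag⇒↭ (unique∧set⇒bag (Unique.map⁺ f-injective unique) unique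
      (λ {x} → mk⇔ (λ _ → complete x)
                   (λ _ → subst (_∈ map f xs) (f-invol x) (∈-map⁺ f (complete (f x))))))
    where
    f-injective : ∀ {x y} → f x ≡ f y → x ≡ y
    f-injective {x} {y} e = trans (sym (f-invol x)) (trans (cong f e) (f-invol y))

  count-along-involution : ∀ {P Q : Pred A 0ℓ} (P? : Decidable P) (Q? : Decidable Q)
    (f : A → A) → (∀ x → f (f x) ≡ x) →
    ∀ xs → Unique xs → (∀ x → x ∈ xs) →
    (∀ x → P (f x) → Q x) → (∀ x → Q x → P (f x)) →
    length (filter P? xs) ≡ length (filter Q? xs)
  count-along-involution P? Q? f f-invol xs unique complete pq qp = begin
    length (filter P? xs)               ≡⟨ ↭-length (filter-↭ P? (map-involution-↭ f f-invol xs unique complete)) ⟨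
    length (filter P? (map f xs))       ≡⟨ cong length (filter-map P? f xs) ⟩
    length (map f (filter (P? ∘ f) xs)) ≡⟨ length-map f (filter (P? ∘ f) xs) ⟩
    length (filter (P? ∘ f) xs)         ≡⟨ cong length (filter-≐ (P? ∘ f) Q? ((λ {x} → pq x) , (λ {x} → qp x)) xs) ⟩
    length (filter Q? xs)               ∎
    where open ≡-Reasoning

module _ {A : Set} where

  allVecs-complete : (xs : List A) → (∀ a → a ∈ xs) → ∀ m (v : Vec A m) → v ∈ allVecs xs m
  allVecs-complete xs complete zero [] = here refl
  allVecs-complete xs complete (suc m) (a ∷ v) =
    ∈-concat⁺′ (∈-map⁺ (a ∷_) (allVecs-complete xs complete m v))
               (∈-map⁺ (λ x → map (x ∷_) (allVecs xs m)) (complete a))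

  allVecs-unique : (xs : List A) → Unique xs → ∀ m → Unique (allVecs xs m)
  allVecs-unique xs unique zero = All.[] AllPairs.∷ AllPairs.[]
  allVecs-unique xs unique (suc m) = Unique.concat⁺
      (AllProperties.map⁺ (All.universal (λ x → Unique.map⁺ ∷-injectiveʳ (allVecs-unique xs unique m)) xs))
      (AllPairsProperties.map⁺ (AllPairs.map disjoint unique))
    where
    disjoint : ∀ {x y} → x ≢ y → ∀ {v} → ¬ (v ∈ map (x ∷_) (allVecs xs m) × v ∈ map (y ∷_) (allVecs xs m))
    disjoint x≢y (p , q) with ∈-map⁻ _ p | ∈-map⁻ _ q
    ... | _ , _ , refl | _ , _ , e = x≢y (∷-injectiveˡ e)
allWords-unique : ∀ n → Unique (allWords n)
allWords-unique n = allVecs-unique (allFin n) (Unique.allFin⁺ n) n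

allWords-complete : ∀ n (w : Word n) → w ∈ allWords n
allWords-complete n = allVecs-complete (allFin n) ∈-allFin n

allPairs-unique : ∀ n → Unique (cartesianProduct (allFin n) (allFin n))
allPairs-unique n = Unique.cartesianProduct⁺ (Unique.allFin⁺ n) (Unique.allFin⁺ n)

allPairs-complete : ∀ n (p : Fin n × Fin n) → p ∈ cartesianProduct (allFin n) (allFin n)
allPairs-complete n (i , j) = ∈-cartesianProduct⁺ (∈-allFin i) (∈-allFin j)

Counted : ∀ {n} → Pattern3 → ℕ → Word n → Set
Counted π k ι = (IsInvolution ι × ¬ Contains ι π) × inv ι ≡ k

counted? : ∀ {n} (π : Pattern3) (k : ℕ) → Decidable (Counted {n} π k)
counted? π k ι = (isInvolution? ι ×-dec ¬? (contains? ι π)) ×-dec (inv ι ≟ℕ k)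

invPoly-as-count : ∀ π n k → invPoly π n k ≡ length (filter (counted? π k) (allWords n))
invPoly-as-count π n k = cong length (begin
  filter (λ ι → inv ι ≟ℕ k) (filter (λ ι → ¬? (contains? ι π)) (filter isInvolution? ws))
    ≡⟨ cong (filter (λ ι → inv ι ≟ℕ k)) (filter-filter isInvolution? (λ ι → ¬? (contains? ι π)) ws) ⟩
  filter (λ ι → inv ι ≟ℕ k) (filter (λ ι → isInvolution? ι ×-dec ¬? (contains? ι π)) ws)
    ≡⟨ filter-filter (λ ι → isInvolution? ι ×-dec ¬? (contains? ι π)) (λ ι → inv ι ≟ℕ k) ws ⟩
  filter (counted? π k) ws ∎)
  where
  open ≡-Reasoning
  ws = allWords n

invPoly-symmetry : ∀ {n} (π₁ π₂ : Pattern3) (f : Word n → Word n) →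
  (∀ w → f (f w) ≡ w) →
  (∀ ι → IsInvolution ι → IsInvolution (f ι)) →
  (∀ w → inv (f w) ≡ inv w) →
  (∀ ι → IsInvolution ι → Contains (f ι) π₁ ⇔ Contains ι π₂) →
  SameInvPoly π₁ π₂ n
invPoly-symmetry {n} π₁ π₂ f f-invol f-pres f-inv f-cont k = begin
  invPoly π₁ n k                            ≡⟨ invPoly-as-count π₁ n k ⟩
  length (filter (counted? π₁ k) (allWords n))
    ≡⟨ count-along-involution (counted? π₁ k) (counted? π₂ k) f f-invol (allWords n)
         (allWords-unique n) (allWords-complete n) forth back ⟩
  length (filter (counted? π₂ k) (allWords n)) ≡⟨ invPoly-as-count π₂ n k ⟨
  invPoly π₂ n k                            ∎
  where
  open ≡-Reasoning
  forth : ∀ ι → Counted π₁ k (f ι) → Counted π₂ k ι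
  forth ι ((fι-invol , avoid) , inv≡k) =
    (ι-invol , avoid ∘ from (f-cont ι ι-invol)) , trans (sym (f-inv ι)) inv≡k
    where ι-invol = subst IsInvolution (f-invol ι) (f-pres (f ι) fι-invol)
  back : ∀ ι → Counted π₂ k ι → Counted π₁ k (f ι)
  back ι ((ι-invol , avoid) , inv≡k) =
    (f-pres ι ι-invol , avoid ∘ to (f-cont ι ι-invol)) , trans (f-inv ι) inv≡k

opposite-reverses-< : ∀ {n} {i j : Fin n} → i < j → opposite j < opposite i
opposite-reverses-< {n} {i} {j} i<j rewrite opposite-prop i | opposite-prop j =
  ∸-monoʳ-<ℕ (s≤s i<j) (toℕ<n j)

opposite-reflects-< : ∀ {n} {i j : Fin n} → opposite i < opposite j → j < i
opposite-reflects-< {i = i} {j} p =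
  subst₂ _<_ (opposite-involutive j) (opposite-involutive i) (opposite-reverses-< p)

-- The reverse-complement of a word: reverse the positions and complement the values,
-- i.e. rotate its permutation diagram by a half turn.  Patterns are words too.
rc : ∀ {n} → Word n → Word n
rc w = tabulate (λ i → opposite (lookup w (opposite i)))

lookup-rc : ∀ {n} (w : Word n) i → lookup (rc w) i ≡ opposite (lookup w (opposite i))
lookup-rc w i = lookup∘tabulate _ i

lookup-rc-opposite : ∀ {n} (w : Word n) i → lookup (rc w) (opposite i) ≡ opposite (lookup w i)
lookup-rc-opposite w i =
  trans (lookup-rc w (opposite i)) (cong (opposite ∘ lookup w) (opposite-involutive i))

rc-involutive : ∀ {n} (w : Word n) → rc (rc w) ≡ w
rc-involutive w = trans (tabulate-cong rc-rc-at) (tabulate∘lookup w)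
  where
  rc-rc-at : ∀ i → opposite (lookup (rc w) (opposite i)) ≡ lookup w i
  rc-rc-at i = trans (cong opposite (lookup-rc-opposite w i)) (opposite-involutive _)

-- The half-turn commutes with composition, so it maps involutions to involutions.
rc-preserves-involution : ∀ {n} (w : Word n) → IsInvolution w → IsInvolution (rc w)
rc-preserves-involution w w-invol i = begin
  lookup (rc w) (lookup (rc w) i)                 ≡⟨ cong (lookup (rc w)) (lookup-rc w i) ⟩
  lookup (rc w) (opposite (lookup w (opposite i))) ≡⟨ lookup-rc-opposite w _ ⟩
  opposite (lookup w (lookup w (opposite i)))     ≡⟨ cong opposite (w-invol (opposite i)) ⟩
  opposite (opposite i)                           ≡⟨ opposite-involutive i ⟩
  i                                               ∎
  where open ≡-Reasoning

-- An inversion (i , j) of rc w corresponds to the inversion (opposite j , opposite i) of w.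
inv-rc : ∀ {n} (w : Word n) → inv (rc w) ≡ inv w
inv-rc {n} w = count-along-involution _ _ mirror mirror-involutive
  (cartesianProduct (allFin n) (allFin n)) (allPairs-unique n) (allPairs-complete n) forth back
  where
  mirror : Fin n × Fin n → Fin n × Fin n
  mirror (i , j) = opposite j , opposite i
  mirror-involutive : ∀ p → mirror (mirror p) ≡ p
  mirror-involutive (i , j) = cong₂ _,_ (opposite-involutive i) (opposite-involutive j)
  forth : ∀ p → _
  forth (i , j) (j′<i′ , inversion) =
    opposite-reflects-< j′<i′ ,
    opposite-reflects-< (subst₂ _<_ (lookup-rc-opposite w i) (lookup-rc-opposite w j) inversion)
  back : ∀ p → _
  back (i , j) (i<j , inversion) =
    opposite-reverses-< i<j ,
    subst₂ _<_ (sym (lookup-rc-opposite w i)) (sym (lookup-rc-opposite w j)) (opposite-reverses-< inversion)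

values : ∀ {n} → Word n → Fin n → Fin n → Fin n → Fin 3 → Fin n
values σ i j l a = lookup σ (lookup (i ∷ j ∷ l ∷ []) a)

contains-rc : ∀ {n} (σ : Word n) (π : Pattern3) → Contains σ π → Contains (rc σ) (rc π)
contains-rc σ π (i , j , l , i<j , j<l , same) =
  opposite l , opposite j , opposite i , opposite-reverses-< j<l , opposite-reverses-< i<j ,
  λ a b → forth a b , back a b
  where
  v = values σ i j l
  v′ = values (rc σ) (opposite l) (opposite j) (opposite i)
  mirrored : ∀ a → v′ a ≡ opposite (v (opposite a))
  mirrored a = trans
    (cong (lookup (rc σ)) (lookup∘tabulate (λ b → opposite (lookup (i ∷ j ∷ l ∷ []) (opposite b))) a))
    (lookup-rc-opposite σ _)
  forth : ∀ a b → v′ a < v′ b → lookup (rc π) a < lookup (rc π) b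
  forth a b s = subst₂ _<_ (sym (lookup-rc π a)) (sym (lookup-rc π b)) (opposite-reverses-<
    (proj₁ (same (opposite b) (opposite a)) (opposite-reflects-< (subst₂ _<_ (mirrored a) (mirrored b) s))))
  back : ∀ a b → lookup (rc π) a < lookup (rc π) b → v′ a < v′ b
  back a b p = subst₂ _<_ (sym (mirrored a)) (sym (mirrored b)) (opposite-reverses-<
    (proj₂ (same (opposite b) (opposite a)) (opposite-reflects-< (subst₂ _<_ (lookup-rc π a) (lookup-rc π b) p))))

invPoly-rc : ∀ (π : Pattern3) n → SameInvPoly (rc π) π n
invPoly-rc π n = invPoly-symmetry {n} (rc π) π rc rc-involutive (λ ι → rc-preserves-involution ι)
  inv-rc (λ ι _ → mk⇔ (reflect ι) (contains-rc ι π))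
  where
  reflect : (ι : Word n) → Contains (rc ι) (rc π) → Contains ι π
  reflect ι c = subst₂ Contains (rc-involutive ι) (rc-involutive π) (contains-rc (rc ι) (rc π) c)

Inverses : Pattern3 → Pattern3 → Set
Inverses π π′ = (∀ a → lookup π′ (lookup π a) ≡ a) × (∀ a → lookup π (lookup π′ a) ≡ a)

increasing-triple : ∀ {n} (g : Fin 3 → Fin n) →
  g zero < g (suc zero) → g (suc zero) < g (suc (suc zero)) →
  ∀ {a b} → a < b → g a < g b
increasing-triple g g₀<g₁ g₁<g₂ {zero}          {suc zero}       _ = g₀<g₁
increasing-triple g g₀<g₁ g₁<g₂ {zero}          {suc (suc zero)} _ = <-trans g₀<g₁ g₁<g₂
increasing-triple g g₀<g₁ g₁<g₂ {suc zero}      {suc (suc zero)} _ = g₁<g₂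
increasing-triple g g₀<g₁ g₁<g₂ {zero}          {zero}           ()
increasing-triple g g₀<g₁ g₁<g₂ {suc _}         {zero}           ()
increasing-triple g g₀<g₁ g₁<g₂ {suc zero}      {suc zero}       (s≤s ())
increasing-triple g g₀<g₁ g₁<g₂ {suc (suc zero)} {suc zero}       (s≤s ())
increasing-triple g g₀<g₁ g₁<g₂ {suc (suc zero)} {suc (suc zero)} (s≤s (s≤s ()))

-- The increasing chain of values read off at the pattern positions π′(0), π′(1), π′(2),
-- i.e. at the places where π takes its values 0, 1, 2.
Chain : ∀ {n} → Word n → Pattern3 → Fin n → Fin n → Fin n → Set
Chain σ π′ i j l =
  values σ i j l (lookup π′ zero) < values σ i j l (lookup π′ (suc zero)) ×
  values σ i j l (lookup π′ (suc zero)) < values σ i j l (lookup π′ (suc (suc zero)))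

sameOrder⇔chain : ∀ {n} {π π′ : Pattern3} → Inverses π π′ →
  (σ : Word n) (i j l : Fin n) → SameOrder σ π i j l ⇔ Chain σ π′ i j l
sameOrder⇔chain {π = π} {π′} (left , right) σ i j l = mk⇔ toChain fromChain
  where
  v = values σ i j l
  π-order : ∀ {a b} → a < b → lookup π (lookup π′ a) < lookup π (lookup π′ b)
  π-order {a} {b} = subst₂ _<_ (sym (right a)) (sym (right b))
  toChain : SameOrder σ π i j l → Chain σ π′ i j l
  toChain same = proj₂ (same _ _) (π-order (s≤s z≤n)) , proj₂ (same _ _) (π-order (s≤s (s≤s z≤n)))
  fromChain : Chain σ π′ i j l → SameOrder σ π i j l
  fromChain (c₀ , c₁) a b = reflect , preserve
    where
    -- v is the increasing chain v ∘ π′ composed with π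
    preserve : ∀ {a b} → lookup π a < lookup π b → v a < v b
    preserve {a} {b} p = subst₂ _<_ (cong v (left a)) (cong v (left b))
      (increasing-triple (v ∘ lookup π′) c₀ c₁ p)
    reflect : v a < v b → lookup π a < lookup π b
    reflect s with <-cmp (lookup π a) (lookup π b)
    ... | tri< p _ _ = p
    ... | tri≈ _ e _ = contradiction (subst (λ x → v x < v b) a≡b s) (<-irrefl refl)
      where a≡b = trans (sym (left a)) (trans (cong (lookup π′) e) (left b))
    ... | tri> _ _ p = ⊥-elim (<-asym s (preserve p))

-- Reading an occurrence of π in an involution ι through ι itself gives an occurrence
-- of the inverse pattern: the values of the occurrence become its positions.
involution-contains-inverse : ∀ {n} {π π′ : Pattern3} → Inverses π π′ →
  (ι : Word n) → IsInvolution ι → Contains ι π → Contains ι π′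
involution-contains-inverse {π = π} {π′} inverses@(left , _) ι ι-invol (i , j , l , i<j , j<l , same) =
  i′ , j′ , l′ , c₀ , c₁ , from (sameOrder⇔chain {π = π′} {π} (swap inverses) ι i′ j′ l′) new-chain
  where
  v = values ι i j l
  g = v ∘ lookup π′
  i′ = g zero
  j′ = g (suc zero)
  l′ = g (suc (suc zero))
  c₀ : i′ < j′
  c₀ = proj₁ (to (sameOrder⇔chain {π = π} {π′} inverses ι i j l) same)
  c₁ : j′ < l′
  c₁ = proj₂ (to (sameOrder⇔chain {π = π} {π′} inverses ι i j l) same)
  new-values : ∀ a → values ι i′ j′ l′ (lookup π a) ≡ lookup (i ∷ j ∷ l ∷ []) a
  new-values a = begin
    lookup ι (lookup (tabulate g) (lookup π a)) ≡⟨ cong (lookup ι) (lookup∘tabulate g (lookup π a)) ⟩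
    lookup ι (v (lookup π′ (lookup π a)))      ≡⟨ cong (lookup ι ∘ v) (left a) ⟩
    lookup ι (v a)                             ≡⟨ ι-invol _ ⟩
    lookup (i ∷ j ∷ l ∷ []) a                  ∎
    where open ≡-Reasoning
  new-chain : Chain ι π i′ j′ l′
  new-chain = subst₂ _<_ (sym (new-values zero)) (sym (new-values (suc zero))) i<j ,
              subst₂ _<_ (sym (new-values (suc zero))) (sym (new-values (suc (suc zero)))) j<l

invPoly-inverse : ∀ {π π′ : Pattern3} → Inverses π π′ → ∀ n → SameInvPoly π π′ n
invPoly-inverse {π} {π′} inverses n = invPoly-symmetry {n} π π′ id (λ _ → refl) (λ _ → id) (λ _ → refl)
  (λ ι ι-invol → mk⇔ (involution-contains-inverse {π = π} {π′} inverses ι ι-invol)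
                     (involution-contains-inverse {π = π′} {π} (swap inverses) ι ι-invol))

rc-213 : rc p213 ≡ p132
rc-213 = refl

inverses-231-312 : Inverses p231 p312
inverses-231-312 = left , right
  where
  left : ∀ a → lookup p312 (lookup p231 a) ≡ a
  left zero = refl
  left (suc zero) = refl
  left (suc (suc zero)) = refl
  right : ∀ a → lookup p231 (lookup p312 a) ≡ a
  right zero = refl
  right (suc zero) = refl
  right (suc (suc zero)) = refl

same-132-213 : ∀ n → SameInvPoly p132 p213 n
same-132-213 n = subst (λ π → SameInvPoly π p213 n) rc-213 (invPoly-rc p213 n)

WilfPair : Pattern3 → Pattern3 → Set
WilfPair π₁ π₂ = SetEq2 π₁ π₂ p132 p213 ⊎ SetEq2 π₁ π₂ p231 p312

wilfPair⇒equal-polynomials : ∀ π₁ π₂ → WilfPair π₁ π₂ → (n : ℕ) → SameInvPoly π₁ π₂ n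
wilfPair⇒equal-polynomials _ _ (inj₁ (inj₁ (refl , refl))) n = same-132-213 n
wilfPair⇒equal-polynomials _ _ (inj₁ (inj₂ (refl , refl))) n = sym ∘ same-132-213 n
wilfPair⇒equal-polynomials _ _ (inj₂ (inj₁ (refl , refl))) n = invPoly-inverse {p231} {p312} inverses-231-312 n
wilfPair⇒equal-polynomials _ _ (inj₂ (inj₂ (refl , refl))) n = sym ∘ invPoly-inverse {p231} {p312} inverses-231-312 n

_≟ₚ_ : (π π′ : Pattern3) → Dec (π ≡ π′)
_≟ₚ_ = ≡-decᵥ _≟_

open import Data.List.Membership.DecPropositional _≟ₚ_ using (_∈?_)

p123 p321 : Pattern3
p123 = zero ∷ suc zero ∷ suc (suc zero) ∷ []
p321 = suc (suc zero) ∷ suc zero ∷ zero ∷ []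

perms3 : List Pattern3
perms3 = p123 ∷ p132 ∷ p213 ∷ p231 ∷ p312 ∷ p321 ∷ []

isPerm3? : (π : Pattern3) → Dec (IsPerm3 π)
isPerm3? π = all? λ a → all? λ b → (lookup π a ≟ lookup π b) →-dec (a ≟ b)

perms3-complete : ∀ π → IsPerm3 π → π ∈ perms3
perms3-complete π = All.lookup enumeration-check (allWords-complete 3 π)
  where
  enumeration-check : All (λ π → IsPerm3 π → π ∈ perms3) (allWords 3)
  enumeration-check = from-yes (All.all? (λ π → isPerm3? π →-dec (π ∈? perms3)) (allWords 3))

-- The coefficients of q⁰, …, q³ in the polynomial of 𝓘₃(π).  For the six patterns:
--   123 ↦ 0 2 0 1,  132, 213 ↦ 1 1 0 1,  231, 312 ↦ 1 2 0 1,  321 ↦ 1 2 0 0.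
profile : Pattern3 → List ℕ
profile π = map (invPoly π 3) (0 ∷ 1 ∷ 2 ∷ 3 ∷ [])

wilfPair? : ∀ π₁ π₂ → Dec (WilfPair π₁ π₂)
wilfPair? π₁ π₂ = setEq2? p132 p213 ⊎-dec setEq2? p231 p312
  where
  setEq2? : ∀ α β → Dec (SetEq2 π₁ π₂ α β)
  setEq2? α β = ((π₁ ≟ₚ α) ×-dec (π₂ ≟ₚ β)) ⊎-dec ((π₁ ≟ₚ β) ×-dec (π₂ ≟ₚ α))

profiles-separate : All (λ π₁ → All (λ π₂ → π₁ ≢ π₂ → profile π₁ ≡ profile π₂ → WilfPair π₁ π₂) perms3) perms3
profiles-separate = from-yes (All.all? (λ π₁ → All.all? (λ π₂ →
  ¬? (π₁ ≟ₚ π₂) →-dec (≡-decₗ _≟ℕ_ (profile π₁) (profile π₂) →-dec wilfPair? π₁ π₂)) perms3) perms3)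

equal-polynomials⇒wilfPair : ∀ π₁ π₂ → IsPerm3 π₁ → IsPerm3 π₂ → π₁ ≢ π₂ →
  ((n : ℕ) → SameInvPoly π₁ π₂ n) → WilfPair π₁ π₂
equal-polynomials⇒wilfPair π₁ π₂ perm₁ perm₂ π₁≢π₂ same =
  All.lookup (All.lookup profiles-separate (perms3-complete π₁ perm₁)) (perms3-complete π₂ perm₂)
    π₁≢π₂ (map-cong (same 3) _)

proposition3p2 : (π₁ π₂ : Pattern3) → IsPerm3 π₁ → IsPerm3 π₂ → π₁ ≢ π₂ →
    (((n : ℕ) → SameInvPoly π₁ π₂ n) → (SetEq2 π₁ π₂ p132 p213 ⊎ SetEq2 π₁ π₂ p231 p312)) ×
    ((SetEq2 π₁ π₂ p132 p213 ⊎ SetEq2 π₁ π₂ p231 p312) → ((n : ℕ) → SameInvPoly π₁ π₂ n))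
proposition3p2 π₁ π₂ perm₁ perm₂ π₁≢π₂ =
  equal-polynomials⇒wilfPair π₁ π₂ perm₁ perm₂ π₁≢π₂ , wilfPair⇒equal-polynomials π₁ π₂
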